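{- Let $\pi:(D,R_D)\to(X,R_X)$ be a Kripke sheaf, $(E,R_E)$ an event model with subsets $[\![\mathrm{Pre}(e)]\!]_\pi\subseteq X$ for $e\in E$, and fix $e\in E$ and $m,n\in\mathbb N$. For any monotone map $f:D^m_X\to D^n_X$ over $X$ (i.e. with $\pi^n\circ f=\pi^m$), writing $p_X^\ast f:D^m_{X\otimes E}\to D^n_{X\otimes E}$, $(\bar a,e')\mapsto(f(\bar a),e')$, we have the equalities of relations $$p_X^\ast f\circ R^m_e=R^n_e\circ f,\qquad (p_X^\ast f)^\dagger\circ R^n_e=R^m_e\circ f^\dagger .$$
   Context: Relations: functions are regarded as relations (their graphs), $\circ$ is relational composition ($a\,(S\circ R)\,c$ iff $aRbSc$ for some $b$), and $R^\dagger$ is the converse relation. A Kripke sheaf over a Kripke frame $(X,R_X)$ is a bounded morphism $\pi:(D,R_D)\to(X,R_X)$ (a function with $aR_Db\Rightarrow\pi(a)R_X\pi(b)$ and such that $\pi(a)R_Xw'$ implies $aR_Db$ for some $b$ with $\pi(b)=w'$) such that $aR_Db$, $aR_Db'$, $\pi(b)=\pi(b')$ imply $b=b'$. For $k\in\mathbb N$, $D^k_X=\{(a_1,\dots,a_k)\in D^k\mid\pi(a_1)=\dots=\pi(a_k)\}$ (with $D^0_X=X$), $\pi^k(\bar a)=\pi(a_i)$, and $\bar aR_{D^k_X}\bar b$ iff $a_iR_Db_i$ for all $i$. An event model is a Kripke frame $(E,R_E)$ with, for each $e\in E$, a precondition sentence $\mathrm{Pre}(e)$ interpreted as $[\![\mathrm{Pre}(e)]\!]_\pi\subseteq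 X$. Set $D^k_{X\otimes E}=\{(\bar a,e')\in D^k_X\times E\mid\pi^k(\bar a)\in[\![\mathrm{Pre}(e')]\!]_\pi\}$. For $e\in E$, let $i^k_e:(\pi^k)^{ -1}[\![\mathrm{Pre}(e)]\!]_\pi\hookrightarrow D^k_X$ be the inclusion and $q^k_e:(\pi^k)^{ -1}[\![\mathrm{Pre}(e)]\!]_\pi\to D^k_{X\otimes E}$, $\bar a\mapsto(\bar a,e)$; define the relation $R^k_e=q^k_e\circ(i^k_e)^\dagger\subseteq D^k_X\times D^k_{X\otimes E}$, i.e. $\bar a\,R^k_e\,(\bar b,e')$ iff $\bar a=\bar b$, $e'=e$ and $\pi^k(\bar a)\in[\![\mathrm{Pre}(e)]\!]_\pi$. -}

module Defs where

open import Data.Nat using (ℕ)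
open import Data.Vec using (Vec)
open import Data.Vec.Relation.Unary.All using (All)
open import Data.Vec.Relation.Binary.Pointwise.Inductive using (Pointwise)
open import Data.Product using (Σ; ∃; _×_; _,_; proj₁; proj₂)
open import Relation.Binary.PropositionalEquality using (_≡_; subst; sym)

Rel : Set → Set → Set₁
Rel A B = A → B → Set

_∘R_ : {A B C : Set} → Rel B C → Rel A B → Rel A C
(S ∘R R) a c = ∃ λ b → R a b × S b c

_† : {A B : Set} → Rel A B → Rel B A
(R †) b a = R a b

graph : {A B : Set} → (A → B) → Rel A B
graph f a b = f a ≡ b

_≐_ : {A B : Set} → Rel A B → Rel A B → Set
R ≐ S = ∀ a b → (R a b → S a b) × (S a b → R a b)

record KripkeSheaf : Set₁ where
  field
    X   : Set
    R_X : Rel X X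
    D   : Set
    R_D : Rel D D
    π   : D → X
    π-mono : ∀ a b → R_D a b → R_X (π a) (π b)
    π-lift : ∀ a w' → R_X (π a) w' → ∃ λ b → R_D a b × π b ≡ w'
    sheaf  : ∀ a b b' → R_D a b → R_D a b' → π b ≡ π b' → b ≡ b'

  -- D^k_X : k-tuples lying over a common world x (for k = 0 this is X)
  DX : ℕ → Set
  DX k = Σ X λ x → Σ (Vec D k) λ as → All (λ a → π a ≡ x) as

  πk : (k : ℕ) → DX k → X
  πk k = proj₁

  RDX : (k : ℕ) → Rel (DX k) (DX k)
  RDX k (x , as , _) (y , bs , _) = Pointwise R_D as bs

record EventModel (S : KripkeSheaf) : Set₁ where
  open KripkeSheaf S
  field
    E   : Set
    R_E : Rel E E
    Pre : E → X → Set
    Pre-prop : ∀ e x (p q : Pre e x) → p ≡ q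

module Update (S : KripkeSheaf) (M : EventModel S) where
  open KripkeSheaf S
  open EventModel M

  DXE : ℕ → Set
  DXE k = Σ (DX k × E) λ { (as , e') → Pre e' (πk k as) }

  Re : (k : ℕ) → E → Rel (DX k) (DXE k)
  Re k e = λ as bep → proj₁ (proj₁ bep) ≡ as × proj₂ (proj₁ bep) ≡ e × Pre e (πk k as)

  pull : (m n : ℕ) (f : DX m → DX n) → (∀ as → πk n (f as) ≡ πk m as)
       → DXE m → DXE n
  pull m n f over ((as , e') , p) = (f as , e') , subst (Pre e') (sym (over as)) p

module Submission where

-- Both identities reduce to three facts about a
-- single tagged element:
--   * pull-preserves-Re : ā R^m_e c  implies  f ā R^n_e (p_X^* f) c;
--   * Re-lifts-along-pull : every R^n_e-successor of f ā is the image under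
--     p_X^* f of an R^m_e-successor of ā (this needs that preconditions are
--     proof-irrelevant, so tagged elements are determined by their data);
--   * Re-reflects-pull : if b̄ R^n_e (p_X^* f) c, then c is the tag of its own
--     underlying tuple ā, and f ā = b̄.
-- The first two give  p_X^* f ∘ R^m_e = R^n_e ∘ f,  the first and third give
-- (p_X^* f)† ∘ R^n_e = R^m_e ∘ f†.

open import Defs
open import Data.Nat using (ℕ)
open import Data.Product using (Σ; _×_; _,_; proj₁; proj₂)
open import Relation.Binary.PropositionalEquality
  using (_≡_; refl; sym; cong; cong₂; subst)

module Naturality (S : KripkeSheaf) (M : EventModel S) where
  open KripkeSheaf S
  open EventModel M
  open Update S M

  tuple : {k : ℕ} → DXE k → DX k
  tuple c = proj₁ (proj₁ c)

  -- Since preconditions are propositions, a tagged element is determined by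
  -- its tuple and its event.
  DXE-≡ : {k : ℕ} {c c' : DXE k} → proj₁ c ≡ proj₁ c' → c ≡ c'
  DXE-≡ {k} {u , p} {.u , q} refl = cong (u ,_) (Pre-prop (proj₂ u) (πk k (proj₁ u)) p q)

  module _ {m n : ℕ} (f : DX m → DX n) (over : ∀ as → πk n (f as) ≡ πk m as) (e : E) where

    pre-forward : ∀ as → Pre e (πk m as) → Pre e (πk n (f as))
    pre-forward as = subst (Pre e) (sym (over as))

    pre-backward : ∀ as → Pre e (πk n (f as)) → Pre e (πk m as)
    pre-backward as = subst (Pre e) (over as)

    pull-preserves-Re : ∀ {as c} → Re m e as c → Re n e (f as) (pull m n f over c)
    pull-preserves-Re {as} (refl , e'≡e , pre) = refl , e'≡e , pre-forward as pre

    Re-lifts-along-pull : ∀ {as d} → Re n e (f as) d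
      → Σ (DXE m) λ c → Re m e as c × pull m n f over c ≡ d
    Re-lifts-along-pull {as} (fas≡ , e'≡e , pre) =
      ((as , e) , pre₀) , (refl , refl , pre₀) , DXE-≡ (cong₂ _,_ (sym fas≡) (sym e'≡e))
      where
      pre₀ : Pre e (πk m as)
      pre₀ = pre-backward as pre

    Re-reflects-pull : ∀ {bs c} → Re n e bs (pull m n f over c)
      → f (tuple c) ≡ bs × Re m e (tuple c) c
    Re-reflects-pull {c = (as , e') , p} (fas≡bs , e'≡e , _) =
      fas≡bs , refl , e'≡e , subst (λ ε → Pre ε (πk m as)) e'≡e p

    pull-∘-Re : (graph (pull m n f over) ∘R Re m e) ≐ (Re n e ∘R graph f)
    pull-∘-Re as c = forward , backward
      where
      forward : (graph (pull m n f over) ∘R Re m e) as c → (Re n e ∘R graph f) as c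
      forward (d , Rd , pd≡c) =
        f as , refl , subst (Re n e (f as)) pd≡c (pull-preserves-Re {as} {d} Rd)

      backward : (Re n e ∘R graph f) as c → (graph (pull m n f over) ∘R Re m e) as c
      backward (bs , fas≡bs , Rc) =
        Re-lifts-along-pull (subst (λ xs → Re n e xs c) (sym fas≡bs) Rc)

    pull†-∘-Re : ((graph (pull m n f over) †) ∘R Re n e) ≐ (Re m e ∘R (graph f †))
    pull†-∘-Re bs c = forward , backward
      where
      forward : ((graph (pull m n f over) †) ∘R Re n e) bs c → (Re m e ∘R (graph f †)) bs c
      forward (d , Rd , pc≡d) =
        let (fa≡bs , Rc) = Re-reflects-pull {bs} {c} (subst (Re n e bs) (sym pc≡d) Rd)
        in tuple c , fa≡bs , Rc

      backward : (Re m e ∘R (graph f †)) bs c → ((graph (pull m n f over) †) ∘R Re n e) bs c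
      backward (as , fas≡bs , Rc) =
        pull m n f over c
        , subst (λ xs → Re n e xs (pull m n f over c)) fas≡bs (pull-preserves-Re {as} {c} Rc)
        , refl

theorem4p6 : (S : KripkeSheaf) (M : EventModel S) (e : EventModel.E M) (m n : ℕ)
    → (f : KripkeSheaf.DX S m → KripkeSheaf.DX S n)
    → (∀ as bs → KripkeSheaf.RDX S m as bs → KripkeSheaf.RDX S n (f as) (f bs))
    → (over : ∀ as → KripkeSheaf.πk S n (f as) ≡ KripkeSheaf.πk S m as)
    → ((graph (Update.pull S M m n f over) ∘R Update.Re S M m e)
    ≐ (Update.Re S M n e ∘R graph f))
    × (((graph (Update.pull S M m n f over) †) ∘R Update.Re S M n e)
    ≐ (Update.Re S M m e ∘R ((graph f) †)))
theorem4p6 S M e m n f _ over = pull-∘-Re f over e , pull†-∘-Re f over e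
  where open Naturality S M
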